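{- $RST_{HF}^m\vdash\forall x\in HF\,\forall y\,(y\subseteq x\rightarrow y\in HF)$.
   Context: The language $\mathcal{L}_{RST}^{\{HF\}}$ is first-order with binary relations $\in,=$, one constant $HF$, connectives $\neg,\wedge,\vee$, the quantifier $\exists$ ($\forall$ and $\to$ are classical abbreviations), and set-abstraction terms. Terms, formulas and the safety relation $\varphi\succ\Theta$ ($\Theta$ a finite set of variables) are defined simultaneously: terms are the variables, $HF$, and $\{x\mid\varphi\}$ whenever $\varphi\succ\{x\}$; atomic formulas are $t=s$, $t\in s$; formulas are closed under $\neg,\wedge,\vee,\exists x$. Safety rules: every atomic formula is $\succ\emptyset$; if $x\notin Fv(t)$, each of $x\neq x$, $x\in t$, $x=t$, $t=x$ is $\succ\{x\}$; if $\varphi\succ\emptyset$ then $\neg\varphi\succ\emptyset$; if $\varphi\succ\Theta$ and $\psi\succ\Theta$ then $\varphi\vee\psi\succ\Theta$; if $\varphi\succ\Theta$, $\psi\succ\Phi$ and ($\Phi\cap Fv(\varphi)=\emptyset$ or $\Theta\cap Fv(\psi)=\emptyset$) then $\varphi\wedge\psi\succ\Theta\cup\Phi$; if $\varphi\succ\Theta$ and $y\in\Theta$ then $\exists y\varphi\succ\Theta\setminus\{y\}$. $RST_{HF}^m$ is the classical first-order theory (with variable-binding term operator) in this language with axioms: Extensionality $\forall z(z\in x\leftrightarrow z\in y)\to x=y$; Comprehension $\forall x(x\in\{x\mid\varphi\}\leftrightarrow\varphi)$ for every legal term $\{x\mid\varphi\}$; $\emptyset\in HF$; $\forall x\forall y(x\in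 HF\wedge y\in HF\to x\cup\{y\}\in HF)$; $\forall y(\emptyset\in y\wedge\forall v,w\in y.\,v\cup\{w\}\in y\to HF\subseteq y)$, with $\emptyset=\{x\mid x\neq x\}$, $\{y\}=\{x\mid x=y\}$, $a\cup b=\{x\mid x\in a\vee x\in b\}$, and $y\subseteq x$ abbreviating $\forall z(z\in y\to z\in x)$. The theory contains no $\in$-induction or foundation axiom. -}

module Defs where

open import Data.Nat using (ℕ; zero; suc; pred; _<ᵇ_; _≡ᵇ_)
open import Data.Bool using (if_then_else_)
open import Data.List using (List; []; _∷_; _++_; [_]; map)
open import Data.List.Membership.Propositional using (_∈_)
open import Data.Product using (_×_)
open import Data.Sum using (_⊎_)
open import Relation.Nullary using (¬_)

infix  7 _≐_ _∈ₛ_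
infixr 6 _∧ₛ_
infixr 5 _∨ₛ_
infixr 4 _⇒ₛ_ _⇔ₛ_
infix  2 _⊢_ _≻_

-- Raw syntax.  'var n' is a de Bruijn index; 'abs φ' is {x | φ} where
-- x is index 0 in φ; 'ex φ' is ∃x φ where x is index 0 in φ.

mutual
  data Term : Set where
    var : ℕ → Term
    HF  : Term
    abs : Form → Term

  data Form : Set where
    _≐_  : Term → Term → Form
    _∈ₛ_ : Term → Term → Form
    ¬ₛ_  : Form → Form
    _∧ₛ_ : Form → Form → Form
    _∨ₛ_ : Form → Form → Form
    ex   : Form → Form

mutual
  data FreeT : ℕ → Term → Set where
    fv-var : ∀ {x} → FreeT x (var x)
    fv-abs : ∀ {x φ} → FreeF (suc x) φ → FreeT x (abs φ)

  data FreeF : ℕ → Form → Set where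
    fv-eqˡ  : ∀ {x t s} → FreeT x t → FreeF x (t ≐ s)
    fv-eqʳ  : ∀ {x t s} → FreeT x s → FreeF x (t ≐ s)
    fv-memˡ : ∀ {x t s} → FreeT x t → FreeF x (t ∈ₛ s)
    fv-memʳ : ∀ {x t s} → FreeT x s → FreeF x (t ∈ₛ s)
    fv-neg  : ∀ {x φ} → FreeF x φ → FreeF x (¬ₛ φ)
    fv-andˡ : ∀ {x φ ψ} → FreeF x φ → FreeF x (φ ∧ₛ ψ)
    fv-andʳ : ∀ {x φ ψ} → FreeF x ψ → FreeF x (φ ∧ₛ ψ)
    fv-orˡ  : ∀ {x φ ψ} → FreeF x φ → FreeF x (φ ∨ₛ ψ)
    fv-orʳ  : ∀ {x φ ψ} → FreeF x ψ → FreeF x (φ ∨ₛ ψ)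
    fv-ex   : ∀ {x φ} → FreeF (suc x) φ → FreeF x (ex φ)

DisjointFv : List ℕ → Form → Set
DisjointFv Θ φ = ∀ v → v ∈ Θ → ¬ FreeF v φ

-- Safety relation φ ≻ Θ  (Θ a finite set of variables, represented by a
-- list; 'safe-set' makes the relation depend only on the underlying set).

data _≻_ : Form → List ℕ → Set where
  safe-eq   : ∀ {t s} → (t ≐ s) ≻ []
  safe-mem  : ∀ {t s} → (t ∈ₛ s) ≻ []
  safe-neq  : ∀ {x} → (¬ₛ (var x ≐ var x)) ≻ [ x ]
  safe-x∈t  : ∀ {x t} → ¬ FreeT x t → (var x ∈ₛ t) ≻ [ x ]
  safe-x=t  : ∀ {x t} → ¬ FreeT x t → (var x ≐ t) ≻ [ x ]
  safe-t=x  : ∀ {x t} → ¬ FreeT x t → (t ≐ var x) ≻ [ x ]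
  safe-neg  : ∀ {φ} → φ ≻ [] → (¬ₛ φ) ≻ []
  safe-or   : ∀ {φ ψ Θ} → φ ≻ Θ → ψ ≻ Θ → (φ ∨ₛ ψ) ≻ Θ
  safe-and  : ∀ {φ ψ Θ Φ} → φ ≻ Θ → ψ ≻ Φ →
              (DisjointFv Φ φ ⊎ DisjointFv Θ ψ) → (φ ∧ₛ ψ) ≻ (Θ ++ Φ)
  -- ∃y φ ≻ Θ ∖ {y}, with y = index 0 of φ; Θ' is Θ ∖ {0} re-indexed
  safe-ex   : ∀ {φ Θ Θ'} → φ ≻ Θ → 0 ∈ Θ →
              (∀ v → (v ∈ Θ' → suc v ∈ Θ) × (suc v ∈ Θ → v ∈ Θ')) →
              ex φ ≻ Θ'
  safe-set  : ∀ {φ Θ Θ'} → (∀ v → (v ∈ Θ → v ∈ Θ') × (v ∈ Θ' → v ∈ Θ)) →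
              φ ≻ Θ → φ ≻ Θ'

mutual
  data LegalT : Term → Set where
    lg-var : ∀ {n} → LegalT (var n)
    lg-HF  : LegalT HF
    lg-abs : ∀ {φ} → LegalF φ → φ ≻ [ 0 ] → LegalT (abs φ)

  data LegalF : Form → Set where
    lg-eq  : ∀ {t s} → LegalT t → LegalT s → LegalF (t ≐ s)
    lg-mem : ∀ {t s} → LegalT t → LegalT s → LegalF (t ∈ₛ s)
    lg-neg : ∀ {φ} → LegalF φ → LegalF (¬ₛ φ)
    lg-and : ∀ {φ ψ} → LegalF φ → LegalF ψ → LegalF (φ ∧ₛ ψ)
    lg-or  : ∀ {φ ψ} → LegalF φ → LegalF ψ → LegalF (φ ∨ₛ ψ)
    lg-ex  : ∀ {φ} → LegalF φ → LegalF (ex φ)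

mutual
  shiftT : ℕ → Term → Term
  shiftT c (var n) = if n <ᵇ c then var n else var (suc n)
  shiftT c HF      = HF
  shiftT c (abs φ) = abs (shiftF (suc c) φ)

  shiftF : ℕ → Form → Form
  shiftF c (t ≐ s)  = shiftT c t ≐ shiftT c s
  shiftF c (t ∈ₛ s) = shiftT c t ∈ₛ shiftT c s
  shiftF c (¬ₛ φ)   = ¬ₛ shiftF c φ
  shiftF c (φ ∧ₛ ψ) = shiftF c φ ∧ₛ shiftF c ψ
  shiftF c (φ ∨ₛ ψ) = shiftF c φ ∨ₛ shiftF c ψ
  shiftF c (ex φ)   = ex (shiftF (suc c) φ)

↑T : Term → Term
↑T = shiftT 0

↑F : Form → Form
↑F = shiftF 0

mutual
  substT : ℕ → Term → Term → Term
  substT k u (var n) =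
    if n <ᵇ k then var n else (if n ≡ᵇ k then u else var (pred n))
  substT k u HF      = HF
  substT k u (abs φ) = abs (substF (suc k) (↑T u) φ)

  substF : ℕ → Term → Form → Form
  substF k u (t ≐ s)  = substT k u t ≐ substT k u s
  substF k u (t ∈ₛ s) = substT k u t ∈ₛ substT k u s
  substF k u (¬ₛ φ)   = ¬ₛ substF k u φ
  substF k u (φ ∧ₛ ψ) = substF k u φ ∧ₛ substF k u ψ
  substF k u (φ ∨ₛ ψ) = substF k u φ ∨ₛ substF k u ψ
  substF k u (ex φ)   = ex (substF (suc k) (↑T u) φ)

_[_≔] : Form → Term → Form
φ [ u ≔] = substF 0 u φ

_⇒ₛ_ : Form → Form → Form
φ ⇒ₛ ψ = (¬ₛ φ) ∨ₛ ψ

_⇔ₛ_ : Form → Form → Form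
φ ⇔ₛ ψ = (φ ⇒ₛ ψ) ∧ₛ (ψ ⇒ₛ φ)

all : Form → Form
all φ = ¬ₛ ex (¬ₛ φ)

∅ₛ : Term
∅ₛ = abs (¬ₛ (var 0 ≐ var 0))

sing : Term → Term
sing y = abs (var 0 ≐ ↑T y)

_∪ₛ_ : Term → Term → Term
a ∪ₛ b = abs ((var 0 ∈ₛ ↑T a) ∨ₛ (var 0 ∈ₛ ↑T b))

_⊆ₛ_ : Term → Term → Form
a ⊆ₛ b = all ((var 0 ∈ₛ ↑T a) ⇒ₛ (var 0 ∈ₛ ↑T b))

data Axiom : Form → Set where
  -- ∀x∀y (∀z (z∈x ↔ z∈y) → x = y)
  ax-ext   : Axiom (all (all (all ((var 0 ∈ₛ var 2) ⇔ₛ (var 0 ∈ₛ var 1))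
                              ⇒ₛ (var 1 ≐ var 0))))
  -- ∀x (x ∈ {x|φ} ↔ φ), for every legal term {x|φ}
  ax-comp  : ∀ {φ} → LegalT (abs φ) →
             Axiom (all ((var 0 ∈ₛ ↑T (abs φ)) ⇔ₛ φ))
  ax-hf∅   : Axiom (∅ₛ ∈ₛ HF)
  -- ∀x∀y (x∈HF ∧ y∈HF → x∪{y} ∈ HF)
  ax-hf∪   : Axiom (all (all (((var 1 ∈ₛ HF) ∧ₛ (var 0 ∈ₛ HF))
                              ⇒ₛ ((var 1 ∪ₛ sing (var 0)) ∈ₛ HF))))
  -- ∀y (∅∈y ∧ ∀v∈y ∀w∈y (v∪{w} ∈ y) → HF ⊆ y)
  ax-hfind : Axiom (all (((∅ₛ ∈ₛ var 0) ∧ₛ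
                          all ((var 0 ∈ₛ var 1) ⇒ₛ
                            all ((var 0 ∈ₛ var 2) ⇒ₛ
                              ((var 1 ∪ₛ sing (var 0)) ∈ₛ var 2))))
                         ⇒ₛ (HF ⊆ₛ var 0)))

-- Classical first-order natural deduction with equality, relative to
-- the axioms of RST^m_HF.  Γ ⊢ φ : φ is derivable from assumptions Γ.
-- Only legal terms/formulas are introduced.

data _⊢_ : List Form → Form → Set where
  assum : ∀ {Γ φ} → φ ∈ Γ → Γ ⊢ φ
  ax    : ∀ {Γ φ} → Axiom φ → Γ ⊢ φ
  ∧I    : ∀ {Γ φ ψ} → Γ ⊢ φ → Γ ⊢ ψ → Γ ⊢ φ ∧ₛ ψ
  ∧E₁   : ∀ {Γ φ ψ} → Γ ⊢ φ ∧ₛ ψ → Γ ⊢ φ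
  ∧E₂   : ∀ {Γ φ ψ} → Γ ⊢ φ ∧ₛ ψ → Γ ⊢ ψ
  ∨I₁   : ∀ {Γ φ ψ} → LegalF ψ → Γ ⊢ φ → Γ ⊢ φ ∨ₛ ψ
  ∨I₂   : ∀ {Γ φ ψ} → LegalF φ → Γ ⊢ ψ → Γ ⊢ φ ∨ₛ ψ
  ∨E    : ∀ {Γ φ ψ χ} → Γ ⊢ φ ∨ₛ ψ → (φ ∷ Γ) ⊢ χ → (ψ ∷ Γ) ⊢ χ → Γ ⊢ χ
  ¬I    : ∀ {Γ φ ψ} → LegalF φ → (φ ∷ Γ) ⊢ ψ → (φ ∷ Γ) ⊢ ¬ₛ ψ → Γ ⊢ ¬ₛ φ
  ¬E    : ∀ {Γ φ ψ} → LegalF ψ → Γ ⊢ φ → Γ ⊢ ¬ₛ φ → Γ ⊢ ψ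
  raa   : ∀ {Γ φ ψ} → LegalF φ → ((¬ₛ φ) ∷ Γ) ⊢ ψ →
          ((¬ₛ φ) ∷ Γ) ⊢ ¬ₛ ψ → Γ ⊢ φ
  ∃I    : ∀ {Γ φ t} → LegalF φ → LegalT t → Γ ⊢ φ [ t ≔] → Γ ⊢ ex φ
  ∃E    : ∀ {Γ φ ψ} → Γ ⊢ ex φ → (φ ∷ map ↑F Γ) ⊢ ↑F ψ → Γ ⊢ ψ
  =refl : ∀ {Γ t} → LegalT t → Γ ⊢ t ≐ t
  =subst : ∀ {Γ φ s t} → LegalF φ → Γ ⊢ s ≐ t → Γ ⊢ φ [ s ≔] → Γ ⊢ φ [ t ≔]

RST⊢ : Form → Set
RST⊢ φ = [] ⊢ φ

module Submission where

-- A subset y of x equals x ∩ y, so it suffices that x ∩ y ∈ HF for all x ∈ HF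
-- and all y.  This follows by HF-induction on {z | z ∈ HF ∧ z ∩ y ∈ HF}, a
-- legal term unlike {z | ∀u (u ⊆ z → u ∈ HF)}: ∅ ∩ y = ∅, and (v ∪ {w}) ∩ y
-- is (v ∩ y) ∪ {w} or v ∩ y according as w ∈ y or not.

open import Defs
open import Data.Nat using (suc; _≟_)
open import Data.Bool using (T)
open import Data.Maybe using (Maybe; just; nothing; is-just; _>>=_; to-witness-T)
open import Data.List using (List; []; _∷_; [_]; map)
open import Data.List.Relation.Binary.Subset.Propositional using (_⊆_)
open import Data.List.Relation.Binary.Subset.Propositional.Properties using (map⁺; ∷⁺ʳ)
open import Data.List.Relation.Unary.Any using (here; there)
open import Data.Sum using (_⊎_; inj₁; inj₂; [_,_])
open import Relation.Nullary using (¬_; yes; no)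
open import Relation.Binary.PropositionalEquality using (refl)

neither : ∀ {A B C : Set} → (C → A ⊎ B) → Maybe (¬ A) → Maybe (¬ B) → Maybe (¬ C)
neither split ¬a? ¬b? = ¬a? >>= λ ¬a → ¬b? >>= λ ¬b → just λ c → [ ¬a , ¬b ] (split c)

mutual
  notFreeT? : ∀ x t → Maybe (¬ FreeT x t)
  notFreeT? x (var n) with n ≟ x
  ... | yes _  = nothing
  ... | no n≢x = just λ { fv-var → n≢x refl }
  notFreeT? x HF      = just λ ()
  notFreeT? x (abs φ) = notFreeF? (suc x) φ >>= λ ¬p → just λ { (fv-abs p) → ¬p p }

  notFreeF? : ∀ x φ → Maybe (¬ FreeF x φ)
  notFreeF? x (t ≐ s)  = neither (λ { (fv-eqˡ p) → inj₁ p ; (fv-eqʳ p) → inj₂ p })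
                                 (notFreeT? x t) (notFreeT? x s)
  notFreeF? x (t ∈ₛ s) = neither (λ { (fv-memˡ p) → inj₁ p ; (fv-memʳ p) → inj₂ p })
                                 (notFreeT? x t) (notFreeT? x s)
  notFreeF? x (¬ₛ φ)   = notFreeF? x φ >>= λ ¬p → just λ { (fv-neg p) → ¬p p }
  notFreeF? x (φ ∧ₛ ψ) = neither (λ { (fv-andˡ p) → inj₁ p ; (fv-andʳ p) → inj₂ p })
                                 (notFreeF? x φ) (notFreeF? x ψ)
  notFreeF? x (φ ∨ₛ ψ) = neither (λ { (fv-orˡ p) → inj₁ p ; (fv-orʳ p) → inj₂ p })
                                 (notFreeF? x φ) (notFreeF? x ψ)
  notFreeF? x (ex φ)   = notFreeF? (suc x) φ >>= λ ¬p → just λ { (fv-ex p) → ¬p p }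

-- Incomplete: only the safety rules needed for the terms below are tried.
≻[]? : ∀ φ → Maybe (φ ≻ [])
≻[]? (t ≐ s)  = just safe-eq
≻[]? (t ∈ₛ s) = just safe-mem
≻[]? (¬ₛ φ)   = ≻[]? φ >>= λ p → just (safe-neg p)
≻[]? (φ ∧ₛ ψ) = ≻[]? φ >>= λ p → ≻[]? ψ >>= λ q → just (safe-and p q (inj₁ λ _ ()))
≻[]? (φ ∨ₛ ψ) = ≻[]? φ >>= λ p → ≻[]? ψ >>= λ q → just (safe-or p q)
≻[]? (ex φ)   = nothing

≻[_]? : ∀ x φ → Maybe (φ ≻ [ x ])
≻[ x ]? (¬ₛ (var a ≐ var b)) with a ≟ x | b ≟ x
... | yes refl | yes refl = just safe-neq
... | _        | _        = nothing
≻[ x ]? (var a ∈ₛ t) with a ≟ x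
... | yes refl = notFreeT? a t >>= λ p → just (safe-x∈t p)
... | no _     = nothing
≻[ x ]? (var a ≐ t) with a ≟ x
... | yes refl = notFreeT? a t >>= λ p → just (safe-x=t p)
... | no _     = nothing
≻[ x ]? (φ ∧ₛ ψ) = ≻[ x ]? φ >>= λ p → ≻[]? ψ >>= λ q → just (safe-and p q (inj₁ λ _ ()))
≻[ x ]? (φ ∨ₛ ψ) = ≻[ x ]? φ >>= λ p → ≻[ x ]? ψ >>= λ q → just (safe-or p q)
≻[ x ]? _        = nothing

mutual
  legalT? : ∀ t → Maybe (LegalT t)
  legalT? (var n) = just lg-var
  legalT? HF      = just lg-HF
  legalT? (abs φ) = legalF? φ >>= λ p → ≻[ 0 ]? φ >>= λ q → just (lg-abs p q)

  legalF? : ∀ φ → Maybe (LegalF φ)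
  legalF? (t ≐ s)  = legalT? t >>= λ p → legalT? s >>= λ q → just (lg-eq p q)
  legalF? (t ∈ₛ s) = legalT? t >>= λ p → legalT? s >>= λ q → just (lg-mem p q)
  legalF? (¬ₛ φ)   = legalF? φ >>= λ p → just (lg-neg p)
  legalF? (φ ∧ₛ ψ) = legalF? φ >>= λ p → legalF? ψ >>= λ q → just (lg-and p q)
  legalF? (φ ∨ₛ ψ) = legalF? φ >>= λ p → legalF? ψ >>= λ q → just (lg-or p q)
  legalF? (ex φ)   = legalF? φ >>= λ p → just (lg-ex p)

-- On closed syntax these reduce to ⊤, so implicit arguments of these types
-- are filled in automatically wherever a derived rule is applied.
IsLegalT : Term → Set
IsLegalT t = T (is-just (legalT? t))

IsLegalF : Form → Set
IsLegalF φ = T (is-just (legalF? φ))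

legalT : ∀ t → IsLegalT t → LegalT t
legalT t = to-witness-T (legalT? t)

legalF : ∀ φ → IsLegalF φ → LegalF φ
legalF φ = to-witness-T (legalF? φ)

weaken : ∀ {Γ Δ φ} → Γ ⊆ Δ → Γ ⊢ φ → Δ ⊢ φ
weaken Γ⊆Δ (assum p)        = assum (Γ⊆Δ p)
weaken Γ⊆Δ (ax a)           = ax a
weaken Γ⊆Δ (∧I d e)         = ∧I (weaken Γ⊆Δ d) (weaken Γ⊆Δ e)
weaken Γ⊆Δ (∧E₁ d)          = ∧E₁ (weaken Γ⊆Δ d)
weaken Γ⊆Δ (∧E₂ d)          = ∧E₂ (weaken Γ⊆Δ d)
weaken Γ⊆Δ (∨I₁ l d)        = ∨I₁ l (weaken Γ⊆Δ d)
weaken Γ⊆Δ (∨I₂ l d)        = ∨I₂ l (weaken Γ⊆Δ d)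
weaken Γ⊆Δ (∨E d e f)       = ∨E (weaken Γ⊆Δ d) (weaken (∷⁺ʳ _ Γ⊆Δ) e) (weaken (∷⁺ʳ _ Γ⊆Δ) f)
weaken Γ⊆Δ (¬I l d e)       = ¬I l (weaken (∷⁺ʳ _ Γ⊆Δ) d) (weaken (∷⁺ʳ _ Γ⊆Δ) e)
weaken Γ⊆Δ (¬E l d e)       = ¬E l (weaken Γ⊆Δ d) (weaken Γ⊆Δ e)
weaken Γ⊆Δ (raa l d e)      = raa l (weaken (∷⁺ʳ _ Γ⊆Δ) d) (weaken (∷⁺ʳ _ Γ⊆Δ) e)
weaken Γ⊆Δ (∃I l m d)       = ∃I l m (weaken Γ⊆Δ d)
weaken Γ⊆Δ (∃E d e)         = ∃E (weaken Γ⊆Δ d) (weaken (∷⁺ʳ _ (map⁺ ↑F Γ⊆Δ)) e)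
weaken Γ⊆Δ (=refl l)        = =refl l
weaken Γ⊆Δ (=subst l d e)   = =subst l (weaken Γ⊆Δ d) (weaken Γ⊆Δ e)

weaken-∷ : ∀ {Γ φ ψ} → Γ ⊢ φ → (ψ ∷ Γ) ⊢ φ
weaken-∷ = weaken there

hyp₀ : ∀ {Γ φ} → (φ ∷ Γ) ⊢ φ
hyp₀ = assum (here refl)

hyp₁ : ∀ {Γ φ ψ} → (ψ ∷ φ ∷ Γ) ⊢ φ
hyp₁ = assum (there (here refl))

hyp₂ : ∀ {Γ φ ψ χ} → (χ ∷ ψ ∷ φ ∷ Γ) ⊢ φ
hyp₂ = assum (there (there (here refl)))

-- A primed rule is the primitive rule with its legality side condition
-- discharged by the checker.

∨I₁′ : ∀ {Γ φ ψ} {lψ : IsLegalF ψ} → Γ ⊢ φ → Γ ⊢ φ ∨ₛ ψ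
∨I₁′ {ψ = ψ} {lψ} = ∨I₁ (legalF ψ lψ)

∨I₂′ : ∀ {Γ φ ψ} {lφ : IsLegalF φ} → Γ ⊢ ψ → Γ ⊢ φ ∨ₛ ψ
∨I₂′ {φ = φ} {lφ = lφ} = ∨I₂ (legalF φ lφ)

¬E′ : ∀ {Γ φ ψ} {lψ : IsLegalF ψ} → Γ ⊢ φ → Γ ⊢ ¬ₛ φ → Γ ⊢ ψ
¬E′ {ψ = ψ} {lψ} = ¬E (legalF ψ lψ)

=refl′ : ∀ {Γ} t {lt : IsLegalT t} → Γ ⊢ t ≐ t
=refl′ t {lt} = =refl (legalT t lt)

=subst′ : ∀ {Γ} φ {s t} {lφ : IsLegalF φ} → Γ ⊢ s ≐ t → Γ ⊢ φ [ s ≔] → Γ ⊢ φ [ t ≔]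
=subst′ φ {lφ = lφ} = =subst (legalF φ lφ)

∀I : ∀ {Γ φ} {lφ : IsLegalF φ} → map ↑F Γ ⊢ φ → Γ ⊢ all φ
∀I {φ = φ} {lφ} d =
  ¬I (lg-ex (lg-neg (legalF φ lφ))) (=refl lg-HF)
     (∃E hyp₀ (¬E (lg-neg (lg-eq lg-HF lg-HF)) (weaken (λ p → there (there p)) d) hyp₀))

∀E : ∀ {Γ φ} t {lφ : IsLegalF φ} {lt : IsLegalT t} {lφt : IsLegalF (φ [ t ≔])} →
     Γ ⊢ all φ → Γ ⊢ φ [ t ≔]
∀E {φ = φ} t {lφ} {lt} {lφt} d =
  raa (legalF _ lφt) (∃I (lg-neg (legalF φ lφ)) (legalT t lt) hyp₀) (weaken-∷ d)

excluded-middle : ∀ {Γ} φ {lφ : IsLegalF φ} → Γ ⊢ φ ∨ₛ ¬ₛ φ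
excluded-middle φ {lφ} =
  raa (lg-or l (lg-neg l)) (∨I₂ l (¬I l (∨I₁ (lg-neg l) hyp₀) hyp₁)) hyp₀
  where l = legalF φ lφ

⇒I : ∀ {Γ φ ψ} {lφ : IsLegalF φ} {lψ : IsLegalF ψ} → (φ ∷ Γ) ⊢ ψ → Γ ⊢ φ ⇒ₛ ψ
⇒I {φ = φ} {ψ} {lφ} {lψ} d =
  ∨E (excluded-middle φ {lφ}) (∨I₂ (lg-neg (legalF φ lφ)) d) (∨I₁ (legalF ψ lψ) hyp₀)

⇒E : ∀ {Γ φ ψ} {lψ : IsLegalF ψ} → Γ ⊢ φ ⇒ₛ ψ → Γ ⊢ φ → Γ ⊢ ψ
⇒E {lψ = lψ} d e = ∨E d (¬E′ {lψ = lψ} (weaken-∷ e) hyp₀) hyp₀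

⇔I : ∀ {Γ φ ψ} {lφ : IsLegalF φ} {lψ : IsLegalF ψ} → (φ ∷ Γ) ⊢ ψ → (ψ ∷ Γ) ⊢ φ → Γ ⊢ φ ⇔ₛ ψ
⇔I {lφ = lφ} {lψ} d e = ∧I (⇒I {lφ = lφ} {lψ} d) (⇒I {lφ = lψ} {lφ} e)

⇔E₁ : ∀ {Γ φ ψ} {lψ : IsLegalF ψ} → Γ ⊢ φ ⇔ₛ ψ → Γ ⊢ φ → Γ ⊢ ψ
⇔E₁ {lψ = lψ} d = ⇒E {lψ = lψ} (∧E₁ d)

⇔E₂ : ∀ {Γ φ ψ} {lφ : IsLegalF φ} → Γ ⊢ φ ⇔ₛ ψ → Γ ⊢ ψ → Γ ⊢ φ
⇔E₂ {lφ = lφ} d = ⇒E {lψ = lφ} (∧E₂ d)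

_∩ₛ_ : Term → Term → Term
a ∩ₛ b = abs ((var 0 ∈ₛ ↑T a) ∧ₛ (var 0 ∈ₛ ↑T b))

-- Lets comprehension be invoked with the abstraction itself rather than
-- its defining formula; the fallback clause is never used.
body : Term → Form
body (abs φ) = φ
body _       = ¬ₛ (HF ≐ HF)

Comprehension : Form → Form
Comprehension φ = (var 0 ∈ₛ ↑T (abs φ)) ⇔ₛ φ

comprehension : ∀ {Γ} A t {lA : IsLegalT (abs (body A))} {lt : IsLegalT t}
                {lφ : IsLegalF (Comprehension (body A))}
                {lφt : IsLegalF (Comprehension (body A) [ t ≔])} →
                Γ ⊢ Comprehension (body A) [ t ≔]
comprehension A t {lA} {lt} {lφ} {lφt} =
  ∀E t {lφ} {lt} {lφt} (ax (ax-comp (legalT (abs (body A)) lA)))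

∈HF-resp-≐ : ∀ {Γ s t} → Γ ⊢ s ≐ t → Γ ⊢ s ∈ₛ HF → Γ ⊢ t ∈ₛ HF
∈HF-resp-≐ = =subst′ (var 0 ∈ₛ HF)

∅≐∅∩ : ∀ {Γ} → Γ ⊢ ∅ₛ ≐ (∅ₛ ∩ₛ var 0)
∅≐∅∩ = ⇒E (∀E (∅ₛ ∩ₛ var 0) (∀E ∅ₛ (ax ax-ext))) (∀I (⇔I ∈∅⇒∈∅∩ ∈∅∩⇒∈∅))
  where
  ∈∅⇒∈∅∩ : ∀ {Δ} → ((var 0 ∈ₛ ∅ₛ) ∷ Δ) ⊢ var 0 ∈ₛ (∅ₛ ∩ₛ var 1)
  ∈∅⇒∈∅∩ = ¬E′ (=refl′ (var 0)) (⇔E₁ (comprehension ∅ₛ (var 0)) hyp₀)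
  ∈∅∩⇒∈∅ : ∀ {Δ} → ((var 0 ∈ₛ (∅ₛ ∩ₛ var 1)) ∷ Δ) ⊢ var 0 ∈ₛ ∅ₛ
  ∈∅∩⇒∈∅ = ∧E₁ (⇔E₁ (comprehension (∅ₛ ∩ₛ var 1) (var 0)) hyp₀)

⊆⇒∩≐ : ∀ {Γ} → ((var 0 ⊆ₛ var 1) ∷ Γ) ⊢ (var 1 ∩ₛ var 0) ≐ var 0
⊆⇒∩≐ = ⇒E (∀E (var 0) (∀E (var 1 ∩ₛ var 0) (ax ax-ext))) (∀I (⇔I ∈∩⇒∈ ∈⇒∈∩))
  where
  ∈∩⇒∈ : ∀ {Δ} → ((var 0 ∈ₛ (var 2 ∩ₛ var 1)) ∷ Δ) ⊢ var 0 ∈ₛ var 1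
  ∈∩⇒∈ = ∧E₂ (⇔E₁ (comprehension (var 2 ∩ₛ var 1) (var 0)) hyp₀)
  ∈⇒∈∩ : ∀ {Δ} → ((var 0 ∈ₛ var 1) ∷ (var 1 ⊆ₛ var 2) ∷ Δ) ⊢ var 0 ∈ₛ (var 2 ∩ₛ var 1)
  ∈⇒∈∩ = ⇔E₂ (comprehension (var 2 ∩ₛ var 1) (var 0)) (∧I (⇒E (∀E (var 0) hyp₁) hyp₀) hyp₀)

-- From here on w, v, y are the variables 0, 1, 2, and 1, 2, 3 under the
-- bound variable z of extensionality.

∈∩⇒∈∪sing∩ : ∀ {Γ} → ((var 0 ∈ₛ (var 2 ∩ₛ var 3)) ∷ Γ) ⊢
             var 0 ∈ₛ ((var 2 ∪ₛ sing (var 1)) ∩ₛ var 3)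
∈∩⇒∈∪sing∩ {Γ} =
  ⇔E₂ (comprehension ((var 2 ∪ₛ sing (var 1)) ∩ₛ var 3) (var 0))
      (∧I (⇔E₂ (comprehension (var 2 ∪ₛ sing (var 1)) (var 0)) (∨I₁′ (∧E₁ z∈v∩y))) (∧E₂ z∈v∩y))
  where
  z∈v∩y : ((var 0 ∈ₛ (var 2 ∩ₛ var 3)) ∷ Γ) ⊢ (var 0 ∈ₛ var 2) ∧ₛ (var 0 ∈ₛ var 3)
  z∈v∩y = ⇔E₁ (comprehension (var 2 ∩ₛ var 3) (var 0)) hyp₀

∈∪sing∩⇒∈∪sing : ∀ {Γ} → ((var 0 ∈ₛ ((var 2 ∪ₛ sing (var 1)) ∩ₛ var 3)) ∷ Γ) ⊢
                 (var 0 ∈ₛ (var 2 ∩ₛ var 3)) ∨ₛ (var 0 ∈ₛ sing (var 1))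
∈∪sing∩⇒∈∪sing {Γ} =
  ∨E (⇔E₁ (comprehension (var 2 ∪ₛ sing (var 1)) (var 0)) (∧E₁ z∈v∪w∩y))
     (∨I₁′ (⇔E₂ (comprehension (var 2 ∩ₛ var 3) (var 0)) (∧I hyp₀ (∧E₂ (weaken-∷ z∈v∪w∩y)))))
     (∨I₂′ hyp₀)
  where
  z∈v∪w∩y : ((var 0 ∈ₛ ((var 2 ∪ₛ sing (var 1)) ∩ₛ var 3)) ∷ Γ) ⊢
            (var 0 ∈ₛ (var 2 ∪ₛ sing (var 1))) ∧ₛ (var 0 ∈ₛ var 3)
  z∈v∪w∩y = ⇔E₁ (comprehension ((var 2 ∪ₛ sing (var 1)) ∩ₛ var 3) (var 0)) hyp₀

∩-∪-sing-∈ : ∀ {Γ} → ((var 0 ∈ₛ var 2) ∷ Γ) ⊢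
             ((var 1 ∩ₛ var 2) ∪ₛ sing (var 0)) ≐ ((var 1 ∪ₛ sing (var 0)) ∩ₛ var 2)
∩-∪-sing-∈ = ⇒E (∀E ((var 1 ∪ₛ sing (var 0)) ∩ₛ var 2)
                   (∀E ((var 1 ∩ₛ var 2) ∪ₛ sing (var 0)) (ax ax-ext)))
                (∀I (⇔I forth back))
  where
  z≐w⇒z∈v∪w∩y : ∀ {Δ φ} → ((var 0 ∈ₛ sing (var 1)) ∷ φ ∷ (var 1 ∈ₛ var 3) ∷ Δ) ⊢
                var 0 ∈ₛ ((var 2 ∪ₛ sing (var 1)) ∩ₛ var 3)
  z≐w⇒z∈v∪w∩y {Δ} {φ} =
    ⇔E₂ (comprehension ((var 2 ∪ₛ sing (var 1)) ∩ₛ var 3) (var 0))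
        (∧I (⇔E₂ (comprehension (var 2 ∪ₛ sing (var 1)) (var 0)) (∨I₂′ hyp₀)) z∈y)
    where
    Ctx : List Form
    Ctx = (var 0 ∈ₛ sing (var 1)) ∷ φ ∷ (var 1 ∈ₛ var 3) ∷ Δ
    z≐w : Ctx ⊢ var 0 ≐ var 1
    z≐w = ⇔E₁ (comprehension (sing (var 1)) (var 0)) hyp₀
    w≐z : Ctx ⊢ var 1 ≐ var 0
    w≐z = =subst′ (var 0 ≐ var 1) z≐w (=refl′ (var 0))
    z∈y : Ctx ⊢ var 0 ∈ₛ var 3
    z∈y = =subst′ (var 0 ∈ₛ var 4) w≐z hyp₂
  forth : ∀ {Δ} → ((var 0 ∈ₛ ((var 2 ∩ₛ var 3) ∪ₛ sing (var 1))) ∷ (var 1 ∈ₛ var 3) ∷ Δ) ⊢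
          var 0 ∈ₛ ((var 2 ∪ₛ sing (var 1)) ∩ₛ var 3)
  forth = ∨E (⇔E₁ (comprehension ((var 2 ∩ₛ var 3) ∪ₛ sing (var 1)) (var 0)) hyp₀)
             ∈∩⇒∈∪sing∩ z≐w⇒z∈v∪w∩y
  back : ∀ {Δ} → ((var 0 ∈ₛ ((var 2 ∪ₛ sing (var 1)) ∩ₛ var 3)) ∷ Δ) ⊢
         var 0 ∈ₛ ((var 2 ∩ₛ var 3) ∪ₛ sing (var 1))
  back = ⇔E₂ (comprehension ((var 2 ∩ₛ var 3) ∪ₛ sing (var 1)) (var 0)) ∈∪sing∩⇒∈∪sing

∩-∪-sing-∉ : ∀ {Γ} → ((¬ₛ (var 0 ∈ₛ var 2)) ∷ Γ) ⊢
             (var 1 ∩ₛ var 2) ≐ ((var 1 ∪ₛ sing (var 0)) ∩ₛ var 2)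
∩-∪-sing-∉ = ⇒E (∀E ((var 1 ∪ₛ sing (var 0)) ∩ₛ var 2) (∀E (var 1 ∩ₛ var 2) (ax ax-ext)))
                (∀I (⇔I ∈∩⇒∈∪sing∩ back))
  where
  z≐w⇒w∈y : ∀ {Δ} → ((var 0 ∈ₛ sing (var 1)) ∷ (var 0 ∈ₛ ((var 2 ∪ₛ sing (var 1)) ∩ₛ var 3)) ∷ Δ) ⊢
            var 1 ∈ₛ var 3
  z≐w⇒w∈y = =subst′ (var 0 ∈ₛ var 4) (⇔E₁ (comprehension (sing (var 1)) (var 0)) hyp₀)
              (∧E₂ (⇔E₁ (comprehension ((var 2 ∪ₛ sing (var 1)) ∩ₛ var 3) (var 0)) hyp₁))
  back : ∀ {Δ} → ((var 0 ∈ₛ ((var 2 ∪ₛ sing (var 1)) ∩ₛ var 3)) ∷ (¬ₛ (var 1 ∈ₛ var 3)) ∷ Δ) ⊢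
         var 0 ∈ₛ (var 2 ∩ₛ var 3)
  back = ∨E ∈∪sing∩⇒∈∪sing hyp₀ (¬E′ z≐w⇒w∈y hyp₂)

∪-sing-∩-∈HF : ∀ {Γ} → Γ ⊢ var 0 ∈ₛ HF → Γ ⊢ (var 1 ∩ₛ var 2) ∈ₛ HF →
               Γ ⊢ ((var 1 ∪ₛ sing (var 0)) ∩ₛ var 2) ∈ₛ HF
∪-sing-∩-∈HF w∈HF v∩y∈HF =
  ∨E (excluded-middle (var 0 ∈ₛ var 2))
     (∈HF-resp-≐ ∩-∪-sing-∈
        (⇒E (∀E (var 0) (∀E (var 1 ∩ₛ var 2) (ax ax-hf∪)))
            (∧I (weaken-∷ v∩y∈HF) (weaken-∷ w∈HF))))
     (∈HF-resp-≐ ∩-∪-sing-∉ (weaken-∷ v∩y∈HF))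

Y : Term → Term
Y y = abs ((var 0 ∈ₛ HF) ∧ₛ ((var 0 ∩ₛ ↑T y) ∈ₛ HF))

∅∈Y : ∀ {Γ} → Γ ⊢ ∅ₛ ∈ₛ Y (var 0)
∅∈Y = ⇔E₂ (comprehension (Y (var 0)) ∅ₛ) (∧I (ax ax-hf∅) (∈HF-resp-≐ ∅≐∅∩ (ax ax-hf∅)))

∪-sing-∈Y : ∀ {Γ} → ((var 0 ∈ₛ Y (var 2)) ∷ (var 1 ∈ₛ Y (var 2)) ∷ Γ) ⊢
            (var 1 ∪ₛ sing (var 0)) ∈ₛ Y (var 2)
∪-sing-∈Y {Γ} = ⇔E₂ (comprehension (Y (var 2)) (var 1 ∪ₛ sing (var 0)))
                (∧I v∪w∈HF (∪-sing-∩-∈HF (∧E₁ w∈Y) (∧E₂ v∈Y)))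
  where
  Ctx : List Form
  Ctx = (var 0 ∈ₛ Y (var 2)) ∷ (var 1 ∈ₛ Y (var 2)) ∷ Γ
  v∈Y : Ctx ⊢ (var 1 ∈ₛ HF) ∧ₛ ((var 1 ∩ₛ var 2) ∈ₛ HF)
  v∈Y = ⇔E₁ (comprehension (Y (var 2)) (var 1)) hyp₁
  w∈Y : Ctx ⊢ (var 0 ∈ₛ HF) ∧ₛ ((var 0 ∩ₛ var 2) ∈ₛ HF)
  w∈Y = ⇔E₁ (comprehension (Y (var 2)) (var 0)) hyp₀
  v∪w∈HF : Ctx ⊢ (var 1 ∪ₛ sing (var 0)) ∈ₛ HF
  v∪w∈HF = ⇒E (∀E (var 0) (∀E (var 1) (ax ax-hf∪))) (∧I (∧E₁ v∈Y) (∧E₁ w∈Y))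

HF⊆Y : ∀ {Γ} → Γ ⊢ HF ⊆ₛ Y (var 0)
HF⊆Y = ⇒E (∀E (Y (var 0)) (ax ax-hfind)) (∧I ∅∈Y (∀I (⇒I (∀I (⇒I ∪-sing-∈Y)))))

∩-∈HF : ∀ {Γ} → ((var 1 ∈ₛ HF) ∷ Γ) ⊢ (var 1 ∩ₛ var 0) ∈ₛ HF
∩-∈HF = ∧E₂ (⇔E₁ (comprehension (Y (var 0)) (var 1)) (⇒E (∀E (var 1) HF⊆Y) hyp₀))

lemma4p2 : RST⊢ (all ((var 0 ∈ₛ HF) ⇒ₛ all ((var 0 ⊆ₛ var 1) ⇒ₛ (var 0 ∈ₛ HF))))
lemma4p2 = ∀I (⇒I (∀I (⇒I (∈HF-resp-≐ ⊆⇒∩≐ (weaken-∷ ∩-∈HF)))))
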